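{- Let $\chi$ be a rainbow-free coloring of $[3]^3$ using exactly 10 colors. Then $\chi$ is minimal, i.e., all colors but one appear on exactly one point each; moreover, for every coordinate $t\in\{1,2,3\}$, the color appearing on more than one point (the dominant color) is the color common to all three layers $L_i=\{x\in[3]^3:x_t=i\}$, $i=1,2,3$.
   Context: $[3]^n$ is the set of words $x=(x_1,\dots,x_n)$ with $x_i\in\{1,2,3\}$. A combinatorial line is determined by a word $w\in(\{1,2,3\}\cup\{*\})^n$ containing at least one $*$; it consists of the 3 points $w(1),w(2),w(3)$, where $w(i)$ is obtained from $w$ by replacing every $*$ by $i$. A line is rainbow if its 3 points receive 3 pairwise different colors; a coloring is rainbow-free if no combinatorial line is rainbow. A coloring is minimal if all colors but one appear only once; the color appearing multiple times is called dominant. -}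

module Defs where

open import Data.Nat using (ℕ)
open import Data.Fin using (Fin)
open import Data.Maybe using (Maybe; nothing; just; fromMaybe)
open import Data.Vec using (Vec; map)
open import Data.Vec.Relation.Unary.Any using (Any)
open import Data.Product using (Σ; ∃; _×_; _,_)
open import Function.Definitions using (Injective)
open import Relation.Binary.PropositionalEquality using (_≡_)
open import Relation.Nullary using (¬_)
open import Function.Bundles using (_⇔_)

-- Points of [3]^n : words of length n over {1,2,3} (encoded as Fin 3).
Point : ℕ → Set
Point n = Vec (Fin 3) n

-- Words over {1,2,3} ∪ {*}; * is encoded as nothing.
Word : ℕ → Set
Word n = Vec (Maybe (Fin 3)) n

-- A word determines a combinatorial line iff it contains at least one *.
HasStar : ∀ {n} → Word n → Set
HasStar w = Any (_≡ nothing) w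

inst : ∀ {n} → Word n → Fin 3 → Point n
inst w i = map (fromMaybe i) w

Coloring : ℕ → Set → Set
Coloring n C = Point n → C

Rainbow : ∀ {n C} → Coloring n C → Word n → Set
Rainbow χ w =
  ¬ (χ (inst w Fin.zero) ≡ χ (inst w (Fin.suc Fin.zero)))
  × ¬ (χ (inst w Fin.zero) ≡ χ (inst w (Fin.suc (Fin.suc Fin.zero))))
  × ¬ (χ (inst w (Fin.suc Fin.zero)) ≡ χ (inst w (Fin.suc (Fin.suc Fin.zero))))
  where import Data.Fin as Fin

RainbowFree : ∀ {n C} → Coloring n C → Set
RainbowFree χ = ∀ w → HasStar w → ¬ Rainbow χ w

UsesExactly : ∀ {n C} → ℕ → Coloring n C → Set
UsesExactly {n} {C} k χ =
  Σ (Fin k → C) λ f →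
    Injective _≡_ _≡_ f
    × (∀ (x : Point n) → ∃ λ i → χ x ≡ f i)
    × (∀ (i : Fin k) → ∃ λ x → χ x ≡ f i)

DominantColor : ∀ {n C} → Coloring n C → C → Set
DominantColor {n} χ d =
  (∃ λ (x : Point n) → ∃ λ (y : Point n) → ¬ (x ≡ y) × χ x ≡ d × χ y ≡ d)
  × (∀ (x y : Point n) → χ x ≡ χ y → ¬ (χ x ≡ d) → x ≡ y)

AppearsInLayer : ∀ {n C} → Coloring n C → Fin n → Fin 3 → C → Set
AppearsInLayer {n} χ t i c = ∃ λ (x : Point n) → Data.Vec.lookup x t ≡ i × χ x ≡ c
  where import Data.Vec

CommonToLayers : ∀ {n C} → Coloring n C → Fin n → C → Set
CommonToLayers χ t c = ∀ (i : Fin 3) → AppearsInLayer χ t i c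

-- Slice [3]ⁿ⁺¹ into three layers along a coordinate. Counting every color once for each
-- layer it meets, the color counts of the layers add up to the number of colors plus an
-- "excess". Every line orthogonal to the layers repeats a color, so if some color of a layer
-- meets no other layer, the two other points of its line give a color shared by the two other
-- layers. Hence either some color meets all three layers (excess ≥ 2), or all colors of some
-- layer are shared (excess ≥ that layer's count), or three distinct colors are shared
-- (excess ≥ 3). Inductively, rainbow-free colorings of [3]¹ and [3]² use at most 2 and 4
-- colors. For 10 colors on [3]³ the layers account for at most 12, so the excess is at most 2
-- and only the first case survives: a color d meets all layers and every other color stays in
-- one layer. This holds in all three directions, so non-dominant colors occur once; and d
-- occurs twice on every axis-parallel line, which forces the d's of different directions to agree.
module Submission where

open import Defs
open import Data.Product using (Σ; _×_)
open import Data.Fin using (Fin)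
open import Relation.Binary.PropositionalEquality using (_≡_)
open import Function.Bundles using (_⇔_)

open import Data.Empty using (⊥-elim)
open import Data.Fin using (zero; suc; punchIn; punchOut) renaming (_≟_ to _≟ᶠ_)
import Data.Fin.Properties as Finₚ
open Finₚ using (any?; all?; ¬∀⟶∃¬; punchIn-injective; punchInᵢ≢i; punchOut-injective; punchIn-punchOut)
open import Data.Maybe using (nothing; just; fromMaybe)
open import Data.Nat using (ℕ; zero; suc; _+_; _*_; _∸_; _⊔_; _≤_; z≤n; s≤s)
open import Data.Nat.Properties
open import Algebra.Properties.CommutativeMonoid.Sum +-0-commutativeMonoid
  using (sum; sum-cong-≗; sum-remove; sum-replicate-zero; ∑-comm; ∑-distrib-+)
open import Data.Product using (∃; ∃₂; _,_; proj₁; proj₂)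
open import Data.Vec using (Vec; []; _∷_; lookup; insertAt; removeAt; replicate; map)
open import Data.Vec.Properties
  using (map-insertAt; map-∘; map-id; insertAt-lookup; insertAt-punchIn; insertAt-removeAt;
         lookup-replicate; tabulate∘lookup; tabulate-cong)
import Data.Vec.Functional as Vector
open import Data.Vec.Functional.Properties using (removeAt-punchOut)
open import Data.Vec.Relation.Unary.Any using (here; there)
open import Function using (_∘_)
open import Function.Bundles using (mk⇔; Equivalence)
open import Function.Definitions using (Injective)
open import Relation.Binary.PropositionalEquality
  using (_≢_; refl; sym; trans; cong; cong₂; subst; module ≡-Reasoning)
open import Relation.Nullary using (Dec; yes; no; ¬_; contradiction)
open import Relation.Nullary.Decidable using (map′; _×-dec_; from-no)
open import Relation.Unary using (Decidable)

-- Finite sums and counting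

sum-mono-≤ : ∀ {n} {f g : Fin n → ℕ} → (∀ i → f i ≤ g i) → sum f ≤ sum g
sum-mono-≤ {zero}  f≤g = z≤n
sum-mono-≤ {suc n} f≤g = +-mono-≤ (f≤g zero) (sum-mono-≤ (f≤g ∘ suc))

sum-ones : ∀ n → sum {n} (λ _ → 1) ≡ n
sum-ones zero    = refl
sum-ones (suc n) = cong suc (sum-ones n)

≤-sum : ∀ {n} (f : Fin n → ℕ) i → f i ≤ sum f
≤-sum f zero    = m≤m+n _ _
≤-sum f (suc i) = ≤-trans (≤-sum (f ∘ suc) i) (m≤n+m _ _)

+-≤-sum : ∀ {n} (f : Fin (suc n) → ℕ) {i j} → i ≢ j → f i + f j ≤ sum f
+-≤-sum f {i} i≢j = begin
  f i + f _                                    ≡⟨ cong (f i +_) (removeAt-punchOut f i≢j) ⟨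
  f i + Vector.removeAt f i (punchOut i≢j)     ≤⟨ +-monoʳ-≤ (f i) (≤-sum (Vector.removeAt f i) _) ⟩
  f i + sum (Vector.removeAt f i)              ≡⟨ sum-remove f ⟨
  sum f                                        ∎
  where open ≤-Reasoning

sum∘injective≤sum : ∀ {m n} (f : Fin n → ℕ) {s : Fin m → Fin n} → Injective _≡_ _≡_ s → sum (f ∘ s) ≤ sum f
sum∘injective≤sum {zero}          f s-injective = z≤n
sum∘injective≤sum {suc m} {zero}  f {s} s-injective with s zero
... | ()
sum∘injective≤sum {suc m} {suc n} f {s} s-injective = begin
  f (s zero) + sum (f ∘ s ∘ suc)                         ≡⟨ cong (f (s zero) +_) (sum-cong-≗ (removeAt-punchOut f ∘ s₀≢)) ⟨
  f (s zero) + sum (Vector.removeAt f (s zero) ∘ s′)     ≤⟨ +-monoʳ-≤ (f (s zero)) (sum∘injective≤sum _ s′-injective) ⟩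
  f (s zero) + sum (Vector.removeAt f (s zero))          ≡⟨ sum-remove f ⟨
  sum f                                                  ∎
  where
  open ≤-Reasoning
  s₀≢ : ∀ i → s zero ≢ s (suc i)
  s₀≢ i = Finₚ.0≢1+n ∘ s-injective
  s′ : Fin m → Fin n
  s′ i = punchOut (s₀≢ i)
  s′-injective : Injective _≡_ _≡_ s′
  s′-injective eq = Finₚ.suc-injective (s-injective (punchOut-injective (s₀≢ _) (s₀≢ _) eq))

𝟙 : ∀ {A : Set} → Dec A → ℕ
𝟙 (yes _) = 1
𝟙 (no _)  = 0

𝟙-yes : ∀ {A : Set} (A? : Dec A) → A → 𝟙 A? ≡ 1
𝟙-yes (yes _) a = refl
𝟙-yes (no ¬a) a = ⊥-elim (¬a a)

𝟙-no : ∀ {A : Set} (A? : Dec A) → ¬ A → 𝟙 A? ≡ 0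
𝟙-no (yes a) ¬a = ⊥-elim (¬a a)
𝟙-no (no _)  ¬a = refl

𝟙-≤ : ∀ {A : Set} (A? : Dec A) {n} → (A → 1 ≤ n) → 𝟙 A? ≤ n
𝟙-≤ (yes a) 1≤n = 1≤n a
𝟙-≤ (no _)  1≤n = z≤n

count : ∀ {n} {P : Fin n → Set} → Decidable P → ℕ
count P? = sum (λ i → 𝟙 (P? i))

count-universal : ∀ {n} {P : Fin n → Set} (P? : Decidable P) → (∀ i → P i) → count P? ≡ n
count-universal {n} P? all = trans (sum-cong-≗ (λ i → 𝟙-yes (P? i) (all i))) (sum-ones n)

count-empty : ∀ {n} {P : Fin n → Set} (P? : Decidable P) → (∀ i → ¬ P i) → count P? ≡ 0
count-empty {n} P? none = trans (sum-cong-≗ (λ i → 𝟙-no (P? i) (none i))) (sum-replicate-zero n)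

1≤count : ∀ {n} {P : Fin n → Set} (P? : Decidable P) {i} → P i → 1 ≤ count P?
1≤count P? {i} p = ≤-trans (≤-reflexive (sym (𝟙-yes (P? i) p))) (≤-sum (λ k → 𝟙 (P? k)) i)

2≤count : ∀ {n} {P : Fin n → Set} (P? : Decidable P) {i j} → i ≢ j → P i → P j → 2 ≤ count P?
2≤count {zero}  P? {()}
2≤count {suc n} P? {i} {j} i≢j p q =
  ≤-trans (≤-reflexive (sym (cong₂ _+_ (𝟙-yes (P? i) p) (𝟙-yes (P? j) q)))) (+-≤-sum (λ k → 𝟙 (P? k)) i≢j)

count-subsingleton : ∀ {n} {P : Fin n → Set} (P? : Decidable P) → (∀ {i j} → P i → P j → i ≡ j) → count P? ≤ 1
count-subsingleton {zero}  P? unique = z≤n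
count-subsingleton {suc n} P? unique with P? zero
... | yes p₀ = s≤s (≤-reflexive (count-empty (P? ∘ suc) λ i p → Finₚ.0≢1+n (unique p₀ p)))
... | no _   = count-subsingleton (P? ∘ suc) λ p q → Finₚ.suc-injective (unique p q)

module Multiplicity {m K} {A : Fin m → Fin K → Set} (A? : ∀ i → Decidable (A i)) where

  multiplicity : Fin K → ℕ
  multiplicity c = count λ i → A? i c

  excess : Fin K → ℕ
  excess c = multiplicity c ∸ 1

  totalExcess : ℕ
  totalExcess = sum excess

  multiplicity≡𝟙+excess : ∀ {B : Fin K → Set} (B? : Decidable B) → (∀ c → B c ⇔ ∃ λ i → A i c) →
    ∀ c → multiplicity c ≡ 𝟙 (B? c) + excess c
  multiplicity≡𝟙+excess B? B⇔⋃A c with B? c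
  ... | yes b = sym (m+[n∸m]≡n (1≤count (λ i → A? i c) (proj₂ (Equivalence.to (B⇔⋃A c) b))))
  ... | no ¬b rewrite count-empty (λ i → A? i c) (λ i a → ¬b (Equivalence.from (B⇔⋃A c) (i , a))) = refl

  ∑count≡count+totalExcess : ∀ {B : Fin K → Set} (B? : Decidable B) → (∀ c → B c ⇔ ∃ λ i → A i c) →
    sum (λ i → count (A? i)) ≡ count B? + totalExcess
  ∑count≡count+totalExcess B? B⇔⋃A = begin
    sum (λ i → count (A? i))          ≡⟨ ∑-comm (λ i c → 𝟙 (A? i c)) ⟩
    sum multiplicity                  ≡⟨ sum-cong-≗ (multiplicity≡𝟙+excess B? B⇔⋃A) ⟩
    sum (λ c → 𝟙 (B? c) + excess c)   ≡⟨ ∑-distrib-+ (λ c → 𝟙 (B? c)) excess ⟩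
    count B? + totalExcess            ∎
    where open ≡-Reasoning

  shared⇒1≤excess : ∀ {i j c} → i ≢ j → A i c → A j c → 1 ≤ excess c
  shared⇒1≤excess i≢j a b = ∸-monoˡ-≤ 1 (2≤count _ i≢j a b)

  excess≡0⇒unique : ∀ {i j c} → excess c ≡ 0 → A i c → A j c → i ≡ j
  excess≡0⇒unique {i} {j} e a b with i ≟ᶠ j
  ... | yes i≡j = i≡j
  ... | no i≢j  = contradiction (subst (1 ≤_) e (shared⇒1≤excess i≢j a b)) λ ()

  universal⇒excess : ∀ {c} → (∀ i → A i c) → excess c ≡ m ∸ 1
  universal⇒excess all = cong (_∸ 1) (count-universal _ all)

-- Colors, slices and lines

Occurs : ∀ {n C} → Coloring n C → C → Set
Occurs χ c = ∃ λ x → χ x ≡ c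

∃-point? : ∀ {n} {P : Point n → Set} → Decidable P → Dec (∃ P)
∃-point? {zero}  P? = map′ ([] ,_) (λ { ([] , p) → p }) (P? [])
∃-point? {suc n} P? =
  map′ (λ (a , x , p) → a ∷ x , p) (λ { (a ∷ x , p) → a , x , p })
       (any? λ a → ∃-point? λ x → P? (a ∷ x))

occurs? : ∀ {n K} (χ : Coloring n (Fin K)) → Decidable (Occurs χ)
occurs? χ c = ∃-point? λ x → χ x ≟ᶠ c

#colors : ∀ {n K} → Coloring n (Fin K) → ℕ
#colors χ = count (occurs? χ)

#colors-point : ∀ {K} (χ : Coloring 0 (Fin K)) → #colors χ ≤ 1
#colors-point χ = count-subsingleton (occurs? χ) λ { ([] , refl) ([] , refl) → refl }

slice : ∀ {n C} → Coloring (suc n) C → Fin (suc n) → Fin 3 → Coloring n C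
slice χ t i x = χ (insertAt x t i)

occurs-slice-lookup : ∀ {n C} (χ : Coloring (suc n) C) t x → Occurs (slice χ t (lookup x t)) (χ x)
occurs-slice-lookup χ t x = removeAt x t , cong χ (insertAt-removeAt x t)

occurs⇔occurs-slice : ∀ {n C} (χ : Coloring (suc n) C) t c → Occurs χ c ⇔ ∃ λ i → Occurs (slice χ t i) c
occurs⇔occurs-slice χ t c = mk⇔
  (λ { (x , refl) → lookup x t , occurs-slice-lookup χ t x })
  (λ { (i , y , eq) → insertAt y t i , eq })

HasStar-insertAt : ∀ {n} (w : Word n) t v → HasStar w → HasStar (insertAt w t v)
HasStar-insertAt w       zero    v w★         = there w★
HasStar-insertAt (x ∷ w) (suc t) v (here p)   = here p
HasStar-insertAt (x ∷ w) (suc t) v (there w★) = there (HasStar-insertAt w t v w★)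

HasStar-insertAt-★ : ∀ {n} (w : Word n) t → HasStar (insertAt w t nothing)
HasStar-insertAt-★ w       zero    = here refl
HasStar-insertAt-★ (x ∷ w) (suc t) = there (HasStar-insertAt-★ w t)

inst-insertAt : ∀ {n} (w : Word n) t v i → inst (insertAt w t v) i ≡ insertAt (inst w i) t (fromMaybe i v)
inst-insertAt w t v i = map-insertAt (fromMaybe i) v w t

rainbow-cong : ∀ {m n C} {χ : Coloring m C} {ψ : Coloring n C} {v w} →
  (∀ i → χ (inst v i) ≡ ψ (inst w i)) → Rainbow χ v → Rainbow ψ w
rainbow-cong {χ = χ} {ψ} {v} {w} eq (r₀₁ , r₀₂ , r₁₂) = transport r₀₁ , transport r₀₂ , transport r₁₂
  where
  transport : ∀ {i j} → χ (inst v i) ≢ χ (inst v j) → ψ (inst w i) ≢ ψ (inst w j)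
  transport {i} {j} r e = r (trans (eq i) (trans e (sym (eq j))))

slice-rainbowFree : ∀ {n C} (χ : Coloring (suc n) C) → RainbowFree χ → ∀ t i → RainbowFree (slice χ t i)
slice-rainbowFree χ rf t i w w★ =
  rf (insertAt w t (just i)) (HasStar-insertAt w t (just i) w★)
  ∘ rainbow-cong {χ = slice χ t i} {χ} {w} {insertAt w t (just i)} (cong χ ∘ sym ∘ inst-insertAt w t (just i))

-- The two points other than the i-th share their color.
NonRainbow : ∀ {C : Set} → (Fin 3 → C) → Set
NonRainbow f = ∃ λ i → f (punchIn i zero) ≡ f (punchIn i (suc zero))

¬rainbow⇒nonRainbow : ∀ {K} (f : Fin 3 → Fin K) →
  ¬ (f zero ≢ f (suc zero) × f zero ≢ f (suc (suc zero)) × f (suc zero) ≢ f (suc (suc zero))) →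
  NonRainbow f
¬rainbow⇒nonRainbow f ¬rainbow
  with f (suc zero) ≟ᶠ f (suc (suc zero)) | f zero ≟ᶠ f (suc (suc zero)) | f zero ≟ᶠ f (suc zero)
... | yes e  | _      | _      = zero , e
... | no _   | yes e  | _      = suc zero , e
... | no _   | no _   | yes e  = suc (suc zero) , e
... | no r₁₂ | no r₀₂ | no r₀₁ = contradiction (r₀₁ , r₀₂ , r₁₂) ¬rainbow

punchIn-0≢1 : ∀ (i : Fin 3) → punchIn i zero ≢ punchIn i (suc zero)
punchIn-0≢1 i = (λ ()) ∘ punchIn-injective i zero (suc zero)

punchIn-cover : ∀ {P : Fin 3 → Set} i → P (punchIn i zero) → P (punchIn i (suc zero)) → ∀ l → l ≢ i → P l
punchIn-cover i p₀ p₁ l l≢i with punchOut (l≢i ∘ sym) | punchIn-punchOut (l≢i ∘ sym)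
... | zero     | refl = p₀
... | suc zero | refl = p₁

nonRainbow-unrepeated : ∀ {C : Set} {f : Fin 3 → C} {i} → NonRainbow f → (∀ j → f j ≡ f i → j ≡ i) →
  f (punchIn i zero) ≡ f (punchIn i (suc zero))
nonRainbow-unrepeated {i = i} (o , eq) unrepeated with o ≟ᶠ i
... | yes refl = eq
... | no o≢i with punchOut o≢i | punchIn-punchOut o≢i
...   | zero     | refl = contradiction (unrepeated _ (sym eq)) (punchIn-0≢1 o ∘ sym)
...   | suc zero | refl = contradiction (unrepeated _ eq) (punchIn-0≢1 o)

vertical : ∀ {n} → Point n → Fin (suc n) → Word (suc n)
vertical x t = insertAt (map just x) t nothing

inst-vertical : ∀ {n} (x : Point n) t i → inst (vertical x t) i ≡ insertAt x t i
inst-vertical x t i = trans (inst-insertAt (map just x) t nothing i)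
                            (cong (λ y → insertAt y t i) (trans (sym (map-∘ (fromMaybe i) just x)) (map-id x)))

vertical-nonRainbow : ∀ {n K} (χ : Coloring (suc n) (Fin K)) → RainbowFree χ →
  ∀ t x → NonRainbow (λ i → slice χ t i x)
vertical-nonRainbow χ rf t x
  with ¬rainbow⇒nonRainbow (λ i → χ (inst (vertical x t) i)) (rf (vertical x t) (HasStar-insertAt-★ (map just x) t))
... | o , eq = o , trans (cong χ (sym (inst-vertical x t _))) (trans eq (cong χ (inst-vertical x t _)))

-- Three parallel slices

module SliceProfile {n K} (χ : Coloring (suc n) (Fin K)) (rf : RainbowFree χ) (t : Fin (suc n)) where

  open Multiplicity (λ i → occurs? (slice χ t i)) public

  ∑#colors-slice≡#colors+totalExcess : sum (λ i → #colors (slice χ t i)) ≡ #colors χ + totalExcess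
  ∑#colors-slice≡#colors+totalExcess = ∑count≡count+totalExcess (occurs? χ) (occurs⇔occurs-slice χ t)

  OccursAwayFrom : Fin 3 → Fin K → Set
  OccursAwayFrom i c = ∀ l → l ≢ i → Occurs (slice χ t l) c

  occursAwayFrom⇒1≤excess : ∀ {i c} → OccursAwayFrom i c → 1 ≤ excess c
  occursAwayFrom⇒1≤excess {i} away =
    shared⇒1≤excess (punchIn-0≢1 i) (away _ (punchInᵢ≢i i zero)) (away _ (punchInᵢ≢i i (suc zero)))

  unshared⇒occursAwayFrom : ∀ {i c} → Occurs (slice χ t i) c → excess c ≡ 0 → ∃ (OccursAwayFrom i)
  unshared⇒occursAwayFrom {i} (p , refl) e =
    slice χ t (punchIn i zero) p ,
    punchIn-cover i (p , refl) (p , sym (nonRainbow-unrepeated (vertical-nonRainbow χ rf t p) unrepeated))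
    where
    unrepeated : ∀ j → slice χ t j p ≡ slice χ t i p → j ≡ i
    unrepeated j eq = excess≡0⇒unique e (p , eq) (p , refl)

  data Profile : Set where
    sharedByAll : (d : Fin K) → (∀ i → Occurs (slice χ t i) d) → Profile
    onlyShared  : (i : Fin 3) → #colors (slice χ t i) ≤ totalExcess → Profile
    threeShared : 3 ≤ totalExcess → Profile

  unshared? : ∀ i → Dec (∃ λ c → Occurs (slice χ t i) c × excess c ≡ 0)
  unshared? i = any? λ c → occurs? (slice χ t i) c ×-dec (excess c ≟ 0)

  profile : Profile
  profile with any? (λ d → all? λ i → occurs? (slice χ t i) d)
  ... | yes (d , common) = sharedByAll d common
  ... | no noCommon with all? unshared?
  ...   | no ¬allUnshared =
          let i , noUnshared = ¬∀⟶∃¬ 3 _ unshared? ¬allUnshared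
          in onlyShared i (sum-mono-≤ λ c → 𝟙-≤ (occurs? (slice χ t i) c) λ o → n≢0⇒n>0 λ e → noUnshared (c , o , e))
  ...   | yes allUnshared =
          threeShared (≤-trans (sum-mono-≤ {g = excess ∘ s} (occursAwayFrom⇒1≤excess ∘ away))
                               (sum∘injective≤sum excess s-injective))
    where
    shared : ∀ i → ∃ (OccursAwayFrom i)
    shared i = let _ , o , e = allUnshared i in unshared⇒occursAwayFrom o e
    s : Fin 3 → Fin K
    s = proj₁ ∘ shared
    away : ∀ i → OccursAwayFrom i (s i)
    away = proj₂ ∘ shared
    s-injective : Injective _≡_ _≡_ s
    s-injective {i} {j} eq with i ≟ᶠ j
    ... | yes i≡j = i≡j
    ... | no i≢j  = ⊥-elim (noCommon (s i , common))
      where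
      common : ∀ l → Occurs (slice χ t l) (s i)
      common l with l ≟ᶠ i
      ... | no l≢i   = away i l l≢i
      ... | yes refl = subst (Occurs (slice χ t l)) (sym eq) (away j l i≢j)

module SliceBound {n K} (χ : Coloring (suc n) (Fin K)) (rf : RainbowFree χ) (t : Fin (suc n))
                  {B} (bound : ∀ i → #colors (slice χ t i) ≤ B) where

  open SliceProfile χ rf t

  #colors+totalExcess≤ : #colors χ + totalExcess ≤ 3 * B
  #colors+totalExcess≤ = subst (_≤ 3 * B) ∑#colors-slice≡#colors+totalExcess (sum-mono-≤ bound)

  onlyShared⇒#colors≤ : ∀ i → #colors (slice χ t i) ≤ totalExcess → #colors χ ≤ 2 * B
  onlyShared⇒#colors≤ i sliceᵢ≤ = +-cancelʳ-≤ totalExcess _ _ (begin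
    #colors χ + totalExcess                      ≡⟨ ∑#colors-slice≡#colors+totalExcess ⟨
    sum #colors-slice                            ≡⟨ sum-remove #colors-slice ⟩
    #colors-slice i + sum (Vector.removeAt #colors-slice i)
                                                 ≤⟨ +-mono-≤ sliceᵢ≤ (sum-mono-≤ (bound ∘ punchIn i)) ⟩
    totalExcess + 2 * B                          ≡⟨ +-comm totalExcess (2 * B) ⟩
    2 * B + totalExcess                          ∎)
    where
    open ≤-Reasoning
    #colors-slice : Fin 3 → ℕ
    #colors-slice l = #colors (slice χ t l)

  #colors≤3B∸2 : 2 ≤ totalExcess → #colors χ ≤ 3 * B ∸ 2
  #colors≤3B∸2 2≤E = m+n≤o⇒m≤o∸n (#colors χ) (≤-trans (+-monoʳ-≤ (#colors χ) 2≤E) #colors+totalExcess≤)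

  #colors-from-slices : #colors χ ≤ 2 * B ⊔ (3 * B ∸ 2)
  #colors-from-slices with profile
  ... | sharedByAll d common =
        m≤n⇒m≤o⊔n (2 * B) (#colors≤3B∸2 (subst (_≤ totalExcess) (universal⇒excess common) (≤-sum excess d)))
  ... | onlyShared i sliceᵢ≤ = m≤n⇒m≤n⊔o (3 * B ∸ 2) (onlyShared⇒#colors≤ i sliceᵢ≤)
  ... | threeShared 3≤E      = m≤n⇒m≤o⊔n (2 * B) (#colors≤3B∸2 (≤-trans (n≤1+n 2) 3≤E))

#colors≤2 : ∀ {K} (χ : Coloring 1 (Fin K)) → RainbowFree χ → #colors χ ≤ 2
#colors≤2 χ rf = SliceBound.#colors-from-slices χ rf zero λ i → #colors-point (slice χ zero i)

#colors≤4 : ∀ {K} (χ : Coloring 2 (Fin K)) → RainbowFree χ → #colors χ ≤ 4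
#colors≤4 χ rf = SliceBound.#colors-from-slices χ rf zero λ i → #colors≤2 (slice χ zero i) (slice-rainbowFree χ rf zero i)

-- Rainbow-free colorings of [3]³ with ten colors

lookup-insertAt-replicate : ∀ {n} {A : Set} (a v : A) {t t′ : Fin (suc n)} → t ≢ t′ →
  lookup (insertAt (replicate n a) t v) t′ ≡ a
lookup-insertAt-replicate {n} a v {t} {t′} t≢t′ = begin
  lookup (insertAt (replicate n a) t v) t′                           ≡⟨ cong (lookup (insertAt (replicate n a) t v)) (punchIn-punchOut t≢t′) ⟨
  lookup (insertAt (replicate n a) t v) (punchIn t (punchOut t≢t′))  ≡⟨ insertAt-punchIn (replicate n a) t v _ ⟩
  lookup (replicate n a) (punchOut t≢t′)                             ≡⟨ lookup-replicate (punchOut t≢t′) a ⟩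
  a                                                                  ∎
  where open ≡-Reasoning

insertAt-lookup-≢ : ∀ {n} {A : Set} (p q : Vec A n) t {i j} → i ≢ j →
  lookup (insertAt p t i) t ≢ lookup (insertAt q t j) t
insertAt-lookup-≢ p q t i≢j eq = i≢j (trans (sym (insertAt-lookup p t _)) (trans eq (insertAt-lookup q t _)))

lookup-ext : ∀ {n} {A : Set} {x y : Vec A n} → (∀ t → lookup x t ≡ lookup y t) → x ≡ y
lookup-ext {x = x} {y} eq = trans (sym (tabulate∘lookup x)) (trans (tabulate-cong eq) (tabulate∘lookup y))

module TenColors (κ : Coloring 3 (Fin 10)) (rf : RainbowFree κ) (onto : ∀ c → Occurs κ c) where

  record Dominant (t : Fin 3) (d : Fin 10) : Set where
    field
      inEverySlice : ∀ i → Occurs (slice κ t i) d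
      confined     : ∀ x y → κ x ≡ κ y → κ x ≢ d → lookup x t ≡ lookup y t
  open Dominant

  -- Opaque: later uses would otherwise normalise the decision procedures inside `profile`,
  -- which is prohibitively expensive.
  opaque
    dominant : ∀ t → ∃ (Dominant t)
    dominant t = fromProfile profile
      where
      open SliceProfile κ rf t
      open SliceBound κ rf t (λ i → #colors≤4 (slice κ t i) (slice-rainbowFree κ rf t i))

      #colors≡10 : #colors κ ≡ 10
      #colors≡10 = count-universal (occurs? κ) onto

      totalExcess≤2 : totalExcess ≤ 2
      totalExcess≤2 = +-cancelˡ-≤ 10 _ _ (subst (λ u → u + totalExcess ≤ 12) #colors≡10 #colors+totalExcess≤)

      fromProfile : Profile → ∃ (Dominant t)
      fromProfile (sharedByAll d common) = d , record { inEverySlice = common ; confined = confined′ }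
        where
        excess≡0 : ∀ {c} → c ≢ d → excess c ≡ 0
        excess≡0 {c} c≢d = n≤0⇒n≡0 (+-cancelˡ-≤ 2 _ _ (begin
          2 + excess c         ≡⟨ cong (_+ excess c) (universal⇒excess common) ⟨
          excess d + excess c  ≤⟨ +-≤-sum excess (c≢d ∘ sym) ⟩
          totalExcess          ≤⟨ totalExcess≤2 ⟩
          2                    ∎))
          where open ≤-Reasoning
        confined′ : ∀ x y → κ x ≡ κ y → κ x ≢ d → lookup x t ≡ lookup y t
        confined′ x y eq κx≢d = excess≡0⇒unique (excess≡0 κx≢d)
          (occurs-slice-lookup κ t x) (subst (Occurs (slice κ t (lookup y t))) (sym eq) (occurs-slice-lookup κ t y))
      fromProfile (onlyShared i sliceᵢ≤) =
        contradiction (subst (_≤ 8) #colors≡10 (onlyShared⇒#colors≤ i sliceᵢ≤)) (from-no (10 ≤? 8))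
      fromProfile (threeShared 3≤E) = contradiction (≤-trans 3≤E totalExcess≤2) (from-no (3 ≤? 2))

  dominant-on-lines : ∀ {t d} → Dominant t d → ∀ p →
    ∃₂ λ i j → i ≢ j × κ (insertAt p t i) ≡ d × κ (insertAt p t j) ≡ d
  dominant-on-lines {t} {d} dom p with vertical-nonRainbow κ rf t p
  ... | o , eq with κ (insertAt p t (punchIn o zero)) ≟ᶠ d
  ...   | yes κ≡d = _ , _ , punchIn-0≢1 o , κ≡d , trans (sym eq) κ≡d
  ...   | no κ≢d  = contradiction (confined dom _ _ eq κ≢d) (insertAt-lookup-≢ p p t (punchIn-0≢1 o))

  -- For t′ ≢ t, the t-lines through (0,0) and (1,1) lie in different t′-slices.
  dominant-in-two-slices : ∀ {t d} → Dominant t d → ∀ t′ →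
    ∃₂ λ x y → κ x ≡ d × κ y ≡ d × lookup x t′ ≢ lookup y t′
  dominant-in-two-slices {t} dom t′ with t ≟ᶠ t′
  ... | yes refl with inEverySlice dom zero | inEverySlice dom (suc zero)
  ...   | p , e | q , e′ = _ , _ , e , e′ , insertAt-lookup-≢ p q t λ ()
  dominant-in-two-slices {t} dom t′ | no t≢t′
    with dominant-on-lines dom (replicate 2 zero) | dominant-on-lines dom (replicate 2 (suc zero))
  ... | i , _ , _ , e , _ | j , _ , _ , e′ , _ =
        _ , _ , e , e′ , λ eq → Finₚ.0≢1+n (trans (sym (lookup-insertAt-replicate zero i t≢t′))
                                                   (trans eq (lookup-insertAt-replicate (suc zero) j t≢t′)))

  dominant-unique : ∀ {t t′ d d′} → Dominant t d → Dominant t′ d′ → d ≡ d′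
  dominant-unique {t′ = t′} {d} {d′} dom dom′ with d ≟ᶠ d′
  ... | yes d≡d′ = d≡d′
  ... | no d≢d′ with dominant-in-two-slices dom t′
  ...   | x , y , κx≡d , κy≡d , x≢y =
          contradiction (confined dom′ x y (trans κx≡d (sym κy≡d)) (d≢d′ ∘ trans (sym κx≡d))) x≢y

  d : Fin 10
  d = proj₁ (dominant zero)

  dominantAt : ∀ t → Dominant t d
  dominantAt t = subst (Dominant t) (dominant-unique (proj₂ (dominant t)) (proj₂ (dominant zero))) (proj₂ (dominant t))

  dominantColor : DominantColor κ d
  dominantColor = twoPoints , λ x y eq κx≢d → lookup-ext λ t → confined (dominantAt t) x y eq κx≢d
    where
    twoPoints : ∃ λ x → ∃ λ y → x ≢ y × κ x ≡ d × κ y ≡ d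
    twoPoints with dominant-on-lines (dominantAt zero) (replicate 2 zero)
    ... | i , j , i≢j , e , e′ =
          _ , _ , insertAt-lookup-≢ (replicate 2 zero) (replicate 2 zero) zero i≢j ∘ cong (λ x → lookup x zero) , e , e′

  commonToLayers⇔dominant : ∀ t c → CommonToLayers κ t c ⇔ c ≡ d
  commonToLayers⇔dominant t c = mk⇔ to from
    where
    to : CommonToLayers κ t c → c ≡ d
    to common with common zero | common (suc zero) | c ≟ᶠ d
    ... | _ | _ | yes c≡d = c≡d
    ... | x , x₀ , κx≡c | y , y₁ , κy≡c | no c≢d =
          contradiction (trans (sym x₀) (trans same-slice y₁)) λ ()
      where
      same-slice : lookup x t ≡ lookup y t
      same-slice = confined (dominantAt t) x y (trans κx≡c (sym κy≡c)) (c≢d ∘ trans (sym κx≡c))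
    from : c ≡ d → CommonToLayers κ t c
    from refl i with inEverySlice (dominantAt t) i
    ... | p , e = insertAt p t i , insertAt-lookup p t i , e

module Recoloring {n K C} {χ : Coloring n C} {κ : Coloring n (Fin K)}
                  (f : Fin K → C) (f-injective : Injective _≡_ _≡_ f) (χ≗f∘κ : ∀ x → χ x ≡ f (κ x)) where

  same-color : ∀ {x y} → χ x ≡ χ y → κ x ≡ κ y
  same-color {x} {y} eq = f-injective (trans (sym (χ≗f∘κ x)) (trans eq (χ≗f∘κ y)))

  rainbowFree : RainbowFree χ → RainbowFree κ
  rainbowFree rf w w★ (r₀₁ , r₀₂ , r₁₂) = rf w w★ (r₀₁ ∘ same-color , r₀₂ ∘ same-color , r₁₂ ∘ same-color)

  occurs : ∀ {c} → (∃ λ x → χ x ≡ f c) → Occurs κ c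
  occurs (x , eq) = x , f-injective (trans (sym (χ≗f∘κ x)) eq)

  dominantColor : ∀ {d} → DominantColor κ d → DominantColor χ (f d)
  dominantColor ((x , y , x≢y , κx≡d , κy≡d) , unique) =
    (x , y , x≢y , trans (χ≗f∘κ x) (cong f κx≡d) , trans (χ≗f∘κ y) (cong f κy≡d)) ,
    λ x y eq χx≢fd → unique x y (same-color eq) (χx≢fd ∘ trans (χ≗f∘κ x) ∘ cong f)

  commonToLayers⇔ : ∀ {t d} → (∀ c → CommonToLayers κ t c ⇔ c ≡ d) → ∀ c → CommonToLayers χ t c ⇔ c ≡ f d
  commonToLayers⇔ {t} {d} κ-common c = mk⇔ to from
    where
    to : CommonToLayers χ t c → c ≡ f d
    to common with common zero
    ... | x , _ , χx≡c = trans (sym χx≡c) (trans (χ≗f∘κ x) (cong f (Equivalence.to (κ-common (κ x)) κ-commonₓ)))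
      where
      κ-commonₓ : CommonToLayers κ t (κ x)
      κ-commonₓ i with common i
      ... | y , yᵢ , χy≡c = y , yᵢ , same-color (trans χy≡c (sym χx≡c))
    from : c ≡ f d → CommonToLayers χ t c
    from refl i with Equivalence.from (κ-common d) refl i
    ... | y , yᵢ , κy≡d = y , yᵢ , trans (χ≗f∘κ y) (cong f κy≡d)

lemma4p2 : (C : Set) (χ : Coloring 3 C) → RainbowFree χ → UsesExactly 10 χ →
    Σ C λ d → DominantColor χ d
      × (∀ (t : Fin 3) (c : C) → CommonToLayers χ t c ⇔ (c ≡ d))
lemma4p2 C χ rf (f , f-injective , colorOf , hit) =
  f d , dominantColor κ-dominantColor , λ t → commonToLayers⇔ (commonToLayers⇔dominant t)
  where
  κ : Coloring 3 (Fin 10)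
  κ = proj₁ ∘ colorOf
  open Recoloring f f-injective (proj₂ ∘ colorOf)
  open TenColors κ (rainbowFree rf) (occurs ∘ hit)
    using (d; commonToLayers⇔dominant) renaming (dominantColor to κ-dominantColor)
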